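{- Let $(T,o)$ be a rooted proper subtree of $L_{n,k}$ of depth $r$. Then \[\mathbb{P}\big(B_r(G_{n,k},o)=T\big)=\mathbb{P}\big(V_{n,k}^{(T,o)}\cap V_k(G_{n,k})=V_k(T)\big).\]
   Context: $\binom{[n]}{j}$ is the set of $j$-element subsets of $[n]$. $L_{n,k}$ is the bipartite graph with vertex classes $\binom{[n]}{k+1}$ and $\binom{[n]}{k}$, with $X\sim Y$ iff $Y\subset X$; for a subgraph $H$, $V_k(H)=V(H)\cap\binom{[n]}{k+1}$, $V_{k-1}(H)=V(H)\cap\binom{[n]}{k}$. A $k$-dimensional hypertree on $[n]$ is a $k$-dimensional simplicial complex $C$ on $[n]$ containing all subsets of size $\le k$, having exactly $\binom{n-1}{k}$ faces of size $k+1$, and with $H_{k-1}(C)$ finite; $\nu_{n,k}(C)=|H_{k-1}(C)|^2/n^{\binom{n-2}{k}}$ defines a probability measure on these. With $C_{n,k}$ of law $\nu_{n,k}$, $G_{n,k}$ is the subgraph of $L_{n,k}$ induced by $\binom{[n]}{k}$ together with the $(k+1)$-element faces of $C_{n,k}$. A proper subtree of $L_{n,k}$ is an induced subtree $T$ such that every $X\in V_k(T)$ has all its $k+1$ neighbours of $L_{n,k}$ in $V(T)$. A rooted proper subtree is a pair $(T,o)$ with $T$ a proper subtree and $o\in V_{k-1}(T)$; it has depth $r$ if every vertex of $T$ is at distance at most $r$ from $o$ in $T$ and some vertex is at distance exactly $r$. $B_s(G,v)$ denotes the ball of radius $s$ around $v$ in $G$ (induced subgraph on vertices at distance $\le s$),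 and $B_r(G_{n,k},o)=T$ means equality as subgraphs of $L_{n,k}$. $V_{n,k}^{(T,o)}$ is the set of $X\in\binom{[n]}{k+1}$ having a neighbour in $L_{n,k}$ belonging to $V_{k-1}(B_{r-2}(T,o))$. -}

module Defs where

open import Data.Bool using (Bool; true; false; _∧_; _∨_; not; if_then_else_; _xor_)
open import Data.Nat using (ℕ; zero; suc; _+_; _*_; _∸_; _≤_; _≡ᵇ_)
open import Data.Nat.Combinatorics using (_C_)
open import Data.Integer using (ℤ; +_; -_) renaming (_+_ to _+ℤ_; _*_ to _*ℤ_; _-_ to _-ℤ_)
open import Data.Fin using (Fin)
open import Data.Fin.Subset using (Subset; ∣_∣)
open import Data.Vec using (Vec; []; _∷_; lookup)
open import Data.List using (List; []; _∷_; _++_; [_]; length; map; filterᵇ; foldr)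
open import Data.List.Membership.Propositional using (_∈_)
open import Data.List.Relation.Unary.All using (All)
open import Data.List.Relation.Unary.Linked using (Linked)
open import Data.List.Relation.Unary.Unique.Propositional using (Unique)
open import Data.Product using (Σ; ∃; _×_)
open import Data.Sum using (_⊎_)
open import Data.Unit using (⊤)
open import Data.Empty using (⊥)
open import Relation.Nullary using (¬_)
open import Relation.Binary.PropositionalEquality using (_≡_)

-- The ground set [n] is Fin n; subsets of [n] are `Subset n` (stdlib), size ∣_∣.

private
  variable
    A : Set
    n : ℕ

eqB : Bool → Bool → Bool
eqB a b = not (a xor b)

anyB : (A → Bool) → List A → Bool
anyB p = foldr (λ x b → p x ∨ b) false

allB : (A → Bool) → List A → Bool
allB p = foldr (λ x b → p x ∧ b) true

sumℕ : List ℕ → ℕ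
sumℕ = foldr _+_ 0

sumℤ : List ℤ → ℤ
sumℤ = foldr _+ℤ_ (+ 0)

allSubs : (n : ℕ) → List (Subset n)
allSubs zero    = [ [] ]
allSubs (suc n) = map (true ∷_) (allSubs n) ++ map (false ∷_) (allSubs n)

sublists : List A → List (List A)
sublists []       = [ [] ]
sublists (x ∷ xs) = map (x ∷_) (sublists xs) ++ sublists xs

eqSub : Subset n → Subset n → Bool
eqSub []       []       = true
eqSub (x ∷ xs) (y ∷ ys) = eqB x y ∧ eqSub xs ys

memB : Subset n → List (Subset n) → Bool
memB X = anyB (eqSub X)

subB : Subset n → Subset n → Bool
subB []       []       = true
subB (y ∷ ys) (x ∷ xs) = (not y ∨ x) ∧ subB ys xs

sizeIs : ℕ → Subset n → Bool
sizeIs j s = ∣ s ∣ ≡ᵇ j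

kSets : (n j : ℕ) → List (Subset n)
kSets n j = filterᵇ (sizeIs j) (allSubs n)

adjL : (k : ℕ) → Subset n → Subset n → Bool
adjL k u v = (sizeIs (suc k) u ∧ sizeIs k v ∧ subB v u)
           ∨ (sizeIs (suc k) v ∧ sizeIs k u ∧ subB u v)

-- Ball of radius s around o in the subgraph of L_{n,k} induced by the
-- vertex set S (given by its Boolean membership function): its vertex set.
ball : (k : ℕ) → (Subset n → Bool) → Subset n → ℕ → Subset n → Bool
ball {n} k S o zero    v = S o ∧ eqSub v o
ball {n} k S o (suc s) v =
  ball k S o s v ∨ (S v ∧ anyB (λ u → ball k S o s u ∧ adjL k u v) (allSubs n))

atDist : (k : ℕ) → (Subset n → Bool) → Subset n → ℕ → Subset n → Set
atDist k S o zero    v = ball k S o zero v ≡ true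
atDist k S o (suc s) v = ball k S o (suc s) v ≡ true × ball k S o s v ≡ false

-- Rooted proper subtrees of L_{n,k} (an induced subgraph is given by its
-- vertex set T).

IsVertexSetOfL : (k : ℕ) → (Subset n → Bool) → Set
IsVertexSetOfL k T = ∀ v → T v ≡ true → (sizeIs k v ∨ sizeIs (suc k) v) ≡ true

IsCycleIn : (k : ℕ) → (Subset n → Bool) → List (Subset n) → Set
IsCycleIn k T []       = ⊥
IsCycleIn k T (v ∷ ws) =
  3 ≤ length (v ∷ ws) × Unique (v ∷ ws) × All (λ u → T u ≡ true) (v ∷ ws)
  × Linked (λ a b → adjL k a b ≡ true) (v ∷ ws ++ [ v ])

IsConnected : (k : ℕ) → (Subset n → Bool) → Set
IsConnected k T = ∀ u v → T u ≡ true → T v ≡ true → ∃ λ s → ball k T u s v ≡ true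

IsInducedSubtree : (k : ℕ) → (Subset n → Bool) → Set
IsInducedSubtree k T =
  IsVertexSetOfL k T × IsConnected k T × (∀ vs → ¬ IsCycleIn k T vs)

IsProperSubtree : (k : ℕ) → (Subset n → Bool) → Set
IsProperSubtree k T =
  IsInducedSubtree k T
  × (∀ X → T X ≡ true → sizeIs (suc k) X ≡ true →
       ∀ Y → adjL k X Y ≡ true → T Y ≡ true)

IsRootedProperSubtree : (k : ℕ) → (Subset n → Bool) → Subset n → Set
IsRootedProperSubtree k T o =
  IsProperSubtree k T × sizeIs k o ≡ true × T o ≡ true

HasDepth : (k : ℕ) → (Subset n → Bool) → Subset n → ℕ → Set
HasDepth k T o r =
  (∀ v → T v ≡ true → ball k T o r v ≡ true)
  × (∃ λ v → T v ≡ true × atDist k T o r v)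

-- Reduced simplicial homology over ℤ of the complex consisting of all
-- subsets of [n] of size ≤ k together with the (k+1)-faces F.
-- Chains are functions Subset n → ℤ (the j-chains being those supported
-- on (j+1)-sets); the empty set is the (-1)-face (augmentation).

Chain : ℕ → Set
Chain n = Subset n → ℤ

negPow : ℕ → ℤ
negPow zero    = + 1
negPow (suc m) = - negPow m

-- for Z ⊂ Y with |Y| = |Z|+1: number of elements of Y smaller than the
-- unique element of Y \ Z
cntBefore : Subset n → Subset n → ℕ
cntBefore []       []       = 0
cntBefore (y ∷ ys) (z ∷ zs) =
  if eqB y z then ((if y then 1 else 0) + cntBefore ys zs) else 0

covers : Subset n → Subset n → Bool
covers Z Y = subB Z Y ∧ (∣ Y ∣ ≡ᵇ suc ∣ Z ∣)

-- boundary: ∂{x0<...<xj} = Σ_i (-1)^i {x0..x̂i..xj}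
bd : Chain n → Chain n
bd {n} c Z =
  sumℤ (map (λ Y → if covers Z Y then negPow (cntBefore Y Z) *ℤ c Y else + 0)
            (allSubs n))

IsCycleChain : (k : ℕ) → Chain n → Set
IsCycleChain k z = (∀ Y → sizeIs k Y ≡ false → z Y ≡ + 0) × (∀ Z → bd z Z ≡ + 0)

IsChainOn : List (Subset n) → Chain n → Set
IsChainOn F c = ∀ X → memB X F ≡ false → c X ≡ + 0

Homologous : List (Subset n) → Chain n → Chain n → Set
Homologous F z z' = ∃ λ c → IsChainOn F c × (∀ Y → z Y -ℤ z' Y ≡ bd c Y)

-- |H_{k-1}(C)| = m  (in particular H_{k-1}(C) is finite): there are m
-- pairwise non-homologous (k-1)-cycles representing every class.
HomologyOrder : (n k : ℕ) → List (Subset n) → ℕ → Set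
HomologyOrder n k F m =
  Σ (Vec (Chain n) m) λ zs →
    (∀ i → IsCycleChain k (lookup zs i))
    × (∀ i j → Homologous F (lookup zs i) (lookup zs j) → i ≡ j)
    × (∀ z → IsCycleChain k z → ∃ λ i → Homologous F z (lookup zs i))

IsHypertree : (n k : ℕ) → List (Subset n) → Set
IsHypertree n k F = length F ≡ (n ∸ 1) C k × ∃ λ m → HomologyOrder n k F m

faceSets : (n k : ℕ) → List (List (Subset n))
faceSets n k = sublists (kSets n (suc k))

IsHomologyOrderFn : (n k : ℕ) → (List (Subset n) → ℕ) → Set
IsHomologyOrderFn n k h =
  ∀ F → F ∈ faceSets n k →
    (IsHypertree n k F × HomologyOrder n k F (h F)) ⊎ (¬ IsHypertree n k F × h F ≡ 0)

-- n^{binom(n-2,k)} · ν_{n,k}(E) = Σ_{C ∈ E} |H_{k-1}(C)|^2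
νNumerator : (n k : ℕ) → (List (Subset n) → ℕ) → (List (Subset n) → Bool) → ℕ
νNumerator n k h E =
  sumℕ (map (λ F → if E F then h F * h F else 0) (faceSets n k))

inG : (k : ℕ) → List (Subset n) → Subset n → Bool
inG k F v = sizeIs k v ∨ memB v F

ballEvent : (n k r : ℕ) → (Subset n → Bool) → Subset n → List (Subset n) → Bool
ballEvent n k r T o F = allB (λ v → eqB (ball k (inG k F) o r v) (T v)) (allSubs n)

-- B_{r-2}(T,o), empty when r < 2
ballMinus2 : (k : ℕ) → (Subset n → Bool) → Subset n → ℕ → Subset n → Bool
ballMinus2 k T o (suc (suc s)) = ball k T o s
ballMinus2 k T o _             = λ _ → false

inV : (n k r : ℕ) → (Subset n → Bool) → Subset n → Subset n → Bool
inV n k r T o X =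
  sizeIs (suc k) X
  ∧ anyB (λ Y → sizeIs k Y ∧ subB Y X ∧ ballMinus2 k T o r Y) (allSubs n)

vEvent : (n k r : ℕ) → (Subset n → Bool) → Subset n → List (Subset n) → Bool
vEvent n k r T o F =
  allB (λ X → not (sizeIs (suc k) X) ∨ eqB (inV n k r T o X ∧ memB X F) (T X))
       (allSubs n)

-- Distances from the root o, a k-set, alternate between k-sets (even) and
-- (k+1)-sets (odd).  If the depth r of T were odd, a vertex X at distance r
-- would be a (k+1)-set; T being proper, all k+1 ≥ 2 facets of X lie in T at
-- distance r − 1, and geodesics from two of them back to o would close a
-- cycle.  So r is even, and every (k+1)-face within distance r − 1 of o
-- hangs below a k-set of B_{r−2}(T,o), i.e. lies in V^{(T,o)}.  Growing the
-- two balls layer by layer, B_r(G_{n,k},o) = T holds exactly when G_{n,k}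
-- contains the faces of T in V^{(T,o)} and no others.  The two events thus
-- coincide face set by face set, and so do their ν-weights.
module Submission where

open import Defs
open import Data.Bool using (Bool; true; false; _∧_; _∨_; not; if_then_else_)
open import Data.Bool.Properties
  using (∨-comm; ∧-zeroʳ; not-¬; ¬-not; T-≡) renaming (_≟_ to _≟ᵇ_)
open import Data.Nat
  using (ℕ; zero; suc; _*_; _≤_; _<_; _≤′_; ≤′-reflexive; ≤′-step; z≤n; s≤s; pred)
open import Data.Nat.Properties using (≡ᵇ⇒≡; ≡⇒≡ᵇ; 1+n≢n; ≤⇒≤′; ≤-refl; ≤-pred; <⇒≤)
open import Data.Fin.Subset using (Subset; ∣_∣)
open import Data.Vec using ([]; _∷_)
open import Data.Vec.Properties using (≡-dec; ∷-injectiveʳ)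
open import Data.List using (List; []; _∷_; _++_; [_])
open import Data.List.Properties using (map-cong)
open import Data.List.Membership.Propositional using (_∈_)
open import Data.List.Membership.Propositional.Properties using (∈-map⁺; ∈-++⁺ˡ; ∈-++⁺ʳ)
open import Data.List.Relation.Unary.Any using (here; there)
open import Data.List.Relation.Unary.All as All using (All; []; _∷_)
open import Data.List.Relation.Unary.AllPairs using ([]; _∷_)
open import Data.List.Relation.Unary.Linked using (Linked; [-]; _∷_)
open import Data.List.Relation.Unary.Unique.Propositional using (Unique)
open import Data.Product using (∃; ∃₂; _×_; _,_; proj₁; proj₂)
open import Data.Sum using (_⊎_; inj₁; inj₂)
open import Data.Empty using (⊥; ⊥-elim)
open import Function.Bundles using (Equivalence)
open import Relation.Nullary using (¬_; yes; no)
open import Relation.Binary.PropositionalEquality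
  using (_≡_; _≢_; refl; sym; trans; cong; cong₂; subst; ≢-sym; module ≡-Reasoning)

private
  variable
    n : ℕ
    a b c : Bool

∧-true⁺ : a ≡ true → b ≡ true → a ∧ b ≡ true
∧-true⁺ refl refl = refl

∧-true⁻ : a ∧ b ≡ true → a ≡ true × b ≡ true
∧-true⁻ {true} {true} refl = refl , refl

∨-true⁺ˡ : a ≡ true → a ∨ b ≡ true
∨-true⁺ˡ refl = refl

∨-true⁺ʳ : b ≡ true → a ∨ b ≡ true
∨-true⁺ʳ {a = true}  _ = refl
∨-true⁺ʳ {a = false} p = p

∨-true⁻ : a ∨ b ≡ true → a ≡ true ⊎ b ≡ true
∨-true⁻ {true}  _ = inj₁ refl
∨-true⁻ {false} p = inj₂ p

∧-cong-guarded : (c ≡ true → a ≡ b) → a ∧ c ≡ b ∧ c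
∧-cong-guarded {true}          a≡b = cong (_∧ true) (a≡b refl)
∧-cong-guarded {false} {a} {b} _   = trans (∧-zeroʳ a) (sym (∧-zeroʳ b))

≡-from-⇔ : (a ≡ true → b ≡ true) → (b ≡ true → a ≡ true) → a ≡ b
≡-from-⇔ {true}          a⇒b _   = sym (a⇒b refl)
≡-from-⇔ {false} {true}  _   b⇒a = b⇒a refl
≡-from-⇔ {false} {false} _   _   = refl

eqB⁺ : a ≡ b → eqB a b ≡ true
eqB⁺ {true}  refl = refl
eqB⁺ {false} refl = refl

eqB⁻ : eqB a b ≡ true → a ≡ b
eqB⁻ {true}  {true}  _ = refl
eqB⁻ {false} {false} _ = refl

eqSub⁻ : (x y : Subset n) → eqSub x y ≡ true → x ≡ y
eqSub⁻ []      []      _ = refl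
eqSub⁻ (a ∷ x) (b ∷ y) p =
  cong₂ _∷_ (eqB⁻ (proj₁ (∧-true⁻ p))) (eqSub⁻ x y (proj₂ (∧-true⁻ p)))

subB-refl : (x : Subset n) → subB x x ≡ true
subB-refl []          = refl
subB-refl (true ∷ x)  = subB-refl x
subB-refl (false ∷ x) = subB-refl x

module _ {A : Set} {p : A → Bool} where

  anyB⁺ : ∀ {xs x} → x ∈ xs → p x ≡ true → anyB p xs ≡ true
  anyB⁺ {y ∷ _} (here refl) px = ∨-true⁺ˡ px
  anyB⁺ {y ∷ _} (there x∈)  px = ∨-true⁺ʳ {a = p y} (anyB⁺ x∈ px)

  anyB⁻ : ∀ xs → anyB p xs ≡ true → ∃ λ x → p x ≡ true
  anyB⁻ (x ∷ xs) e with ∨-true⁻ {p x} e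
  ... | inj₁ px = x , px
  ... | inj₂ e′ = anyB⁻ xs e′

  allB⁺ : ∀ xs → (∀ x → p x ≡ true) → allB p xs ≡ true
  allB⁺ []       _ = refl
  allB⁺ (x ∷ xs) h = ∧-true⁺ (h x) (allB⁺ xs h)

  allB⁻ : ∀ {xs x} → allB p xs ≡ true → x ∈ xs → p x ≡ true
  allB⁻ {y ∷ _} e (here refl) = proj₁ (∧-true⁻ {p y} e)
  allB⁻ {y ∷ _} e (there x∈)  = allB⁻ (proj₂ (∧-true⁻ {p y} e)) x∈

  anyB-cong : ∀ {q : A → Bool} xs → (∀ x → p x ≡ q x) → anyB p xs ≡ anyB q xs
  anyB-cong []       _   = refl
  anyB-cong (x ∷ xs) p≗q = cong₂ _∨_ (p≗q x) (anyB-cong xs p≗q)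

∈-allSubs : ∀ n (x : Subset n) → x ∈ allSubs n
∈-allSubs zero    []          = here refl
∈-allSubs (suc n) (true ∷ x)  = ∈-++⁺ˡ (∈-map⁺ (true ∷_) (∈-allSubs n x))
∈-allSubs (suc n) (false ∷ x) = ∈-++⁺ʳ _ (∈-map⁺ (false ∷_) (∈-allSubs n x))

anyB-allSubs⁺ : (p : Subset n → Bool) (x : Subset n) → p x ≡ true → anyB p (allSubs n) ≡ true
anyB-allSubs⁺ {n} p x = anyB⁺ (∈-allSubs n x)

allB-allSubs⁻ : (p : Subset n → Bool) → allB p (allSubs n) ≡ true → ∀ x → p x ≡ true
allB-allSubs⁻ {n} p e x = allB⁻ e (∈-allSubs n x)

sizeIs⁻ : ∀ {j} (v : Subset n) → sizeIs j v ≡ true → ∣ v ∣ ≡ j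
sizeIs⁻ {j = j} v p = ≡ᵇ⇒≡ ∣ v ∣ j (Equivalence.from T-≡ p)

sizeIs⁺ : ∀ {j} (v : Subset n) → ∣ v ∣ ≡ j → sizeIs j v ≡ true
sizeIs⁺ {j = j} v e = Equivalence.to T-≡ (≡⇒≡ᵇ ∣ v ∣ j e)

sizeIs-disjoint : ∀ {k} (v : Subset n) → sizeIs k v ≡ true → sizeIs (suc k) v ≡ true → ⊥
sizeIs-disjoint v p q = 1+n≢n (trans (sym (sizeIs⁻ v q)) (sizeIs⁻ v p))

sizeIs-suc⇒¬sizeIs : ∀ {k} (v : Subset n) → sizeIs (suc k) v ≡ true → sizeIs k v ≡ false
sizeIs-suc⇒¬sizeIs v q = ¬-not (λ p → sizeIs-disjoint v p q)

record Facet (k : ℕ) (Y X : Subset n) : Set where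
  constructor facet
  field
    X-size : sizeIs (suc k) X ≡ true
    Y-size : sizeIs k Y ≡ true
    Y⊆X    : subB Y X ≡ true

module _ {k : ℕ} where

  adjL-sym : (u v : Subset n) → adjL k u v ≡ adjL k v u
  adjL-sym u v = ∨-comm (sizeIs (suc k) u ∧ sizeIs k v ∧ subB v u) _

  facet⇒adjL-down : {Y X : Subset n} → Facet k Y X → adjL k X Y ≡ true
  facet⇒adjL-down (facet x y y⊆x) = ∨-true⁺ˡ (∧-true⁺ x (∧-true⁺ y y⊆x))

  facet⇒adjL-up : {Y X : Subset n} → Facet k Y X → adjL k Y X ≡ true
  facet⇒adjL-up {Y = Y} {X = X} f = trans (adjL-sym Y X) (facet⇒adjL-down f)

  facet-∧ : {Y X : Subset n} → sizeIs (suc k) X ∧ sizeIs k Y ∧ subB Y X ≡ true → Facet k Y X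
  facet-∧ {X = X} p with ∧-true⁻ {sizeIs (suc k) X} p
  ... | x , q = facet x (proj₁ (∧-true⁻ q)) (proj₂ (∧-true⁻ q))

  adjL⇒facet : (u v : Subset n) → adjL k u v ≡ true → Facet k v u ⊎ Facet k u v
  adjL⇒facet u v e with ∨-true⁻ {sizeIs (suc k) u ∧ sizeIs k v ∧ subB v u} e
  ... | inj₁ p = inj₁ (facet-∧ p)
  ... | inj₂ p = inj₂ (facet-∧ p)

  adjL-from-k-set : (u v : Subset n) → sizeIs k u ≡ true → adjL k u v ≡ true → Facet k u v
  adjL-from-k-set u v ku e with adjL⇒facet u v e
  ... | inj₁ (facet k+1u _ _) = ⊥-elim (sizeIs-disjoint u ku k+1u)
  ... | inj₂ f                = f

  adjL-from-k+1-set : (u v : Subset n) → sizeIs (suc k) u ≡ true → adjL k u v ≡ true →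
                      Facet k v u
  adjL-from-k+1-set u v k+1u e with adjL⇒facet u v e
  ... | inj₁ f              = f
  ... | inj₂ (facet _ ku _) = ⊥-elim (sizeIs-disjoint u ku k+1u)

removeFirst : Subset n → Subset n
removeFirst []           = []
removeFirst (true ∷ xs)  = false ∷ xs
removeFirst (false ∷ xs) = false ∷ removeFirst xs

removeSecond : Subset n → Subset n
removeSecond []           = []
removeSecond (true ∷ xs)  = true ∷ removeFirst xs
removeSecond (false ∷ xs) = false ∷ removeSecond xs

∣removeFirst∣ : ∀ {m} (xs : Subset n) → ∣ xs ∣ ≡ suc m → ∣ removeFirst xs ∣ ≡ m
∣removeFirst∣ (true ∷ xs)  e = cong pred e
∣removeFirst∣ (false ∷ xs) e = ∣removeFirst∣ xs e

∣removeSecond∣ : ∀ {m} (xs : Subset n) → ∣ xs ∣ ≡ suc (suc m) →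
                 ∣ removeSecond xs ∣ ≡ suc m
∣removeSecond∣ (true ∷ xs)  e = cong suc (∣removeFirst∣ xs (cong pred e))
∣removeSecond∣ (false ∷ xs) e = ∣removeSecond∣ xs e

removeFirst-⊆ : (xs : Subset n) → subB (removeFirst xs) xs ≡ true
removeFirst-⊆ []           = refl
removeFirst-⊆ (true ∷ xs)  = subB-refl xs
removeFirst-⊆ (false ∷ xs) = removeFirst-⊆ xs

removeSecond-⊆ : (xs : Subset n) → subB (removeSecond xs) xs ≡ true
removeSecond-⊆ []           = refl
removeSecond-⊆ (true ∷ xs)  = removeFirst-⊆ xs
removeSecond-⊆ (false ∷ xs) = removeSecond-⊆ xs

removeFirst≢removeSecond : ∀ {m} (xs : Subset n) → ∣ xs ∣ ≡ suc (suc m) →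
                           removeFirst xs ≢ removeSecond xs
removeFirst≢removeSecond (true ∷ xs)  _ ()
removeFirst≢removeSecond (false ∷ xs) e eq = removeFirst≢removeSecond xs e (∷-injectiveʳ eq)

two-facets : ∀ {m} (X : Subset n) → sizeIs (suc (suc m)) X ≡ true →
             ∃₂ λ Y Z → Y ≢ Z × Facet (suc m) Y X × Facet (suc m) Z X
two-facets X k+1X =
    removeFirst X , removeSecond X , removeFirst≢removeSecond X ∣X∣
  , facet k+1X (sizeIs⁺ (removeFirst X) (∣removeFirst∣ X ∣X∣)) (removeFirst-⊆ X)
  , facet k+1X (sizeIs⁺ (removeSecond X) (∣removeSecond∣ X ∣X∣)) (removeSecond-⊆ X)
  where ∣X∣ = sizeIs⁻ X k+1X

data Even : ℕ → Set where
  zero : Even zero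
  2+_  : ∀ {m} → Even m → Even (suc (suc m))

data Parity : ℕ → Set where
  even : ∀ {m} → Even m → Parity m
  odd  : ∀ {m} → Even m → Parity (suc m)

parity : ∀ m → Parity m
parity zero = even zero
parity (suc m) with parity m
... | even e = odd e
... | odd e  = even (2+ e)

module _ (k : ℕ) (S : Subset n → Bool) (o : Subset n) where

  ball-zero : ∀ {v} → ball k S o zero v ≡ true → v ≡ o
  ball-zero {v} e = eqSub⁻ v o (proj₂ (∧-true⁻ {S o} e))

  ball-⊆ : ∀ s {v} → ball k S o s v ≡ true → S v ≡ true
  ball-⊆ zero    e = subst (λ x → S x ≡ true) (sym (ball-zero e)) (proj₁ (∧-true⁻ e))
  ball-⊆ (suc s) {v} e with ∨-true⁻ {ball k S o s v} e
  ... | inj₁ p = ball-⊆ s p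
  ... | inj₂ p = proj₁ (∧-true⁻ p)

  ball-suc : ∀ s {v} → ball k S o s v ≡ true → ball k S o (suc s) v ≡ true
  ball-suc s = ∨-true⁺ˡ

  ball-step : ∀ s {u v} → ball k S o s u ≡ true → adjL k u v ≡ true → S v ≡ true →
              ball k S o (suc s) v ≡ true
  ball-step s {u} {v} bu uv Sv =
    ∨-true⁺ʳ {a = ball k S o s v}
      (∧-true⁺ Sv (anyB-allSubs⁺ (λ w → ball k S o s w ∧ adjL k w v) u (∧-true⁺ bu uv)))

  ball-mono : ∀ {s t v} → s ≤ t → ball k S o s v ≡ true → ball k S o t v ≡ true
  ball-mono s≤t = go (≤⇒≤′ s≤t)
    where
    go : ∀ {s t v} → s ≤′ t → ball k S o s v ≡ true → ball k S o t v ≡ true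
    go (≤′-reflexive refl)    bv = bv
    go (≤′-step {n = t} s≤′t) bv = ball-suc t (go s≤′t bv)

  ball-separates : ∀ s {x y} → ball k S o s x ≡ true → ball k S o s y ≡ false → x ≢ y
  ball-separates s bx by refl = not-¬ bx by

  ball-suc-false : ∀ s {x} → ball k S o (suc s) x ≡ false → ball k S o s x ≡ false
  ball-suc-false s {x} f = ¬-not (λ (bx : ball k S o s x ≡ true) → not-¬ (ball-suc s bx) f)

  ball-suc⁻ : ∀ s {v} → ball k S o (suc s) v ≡ true →
              ball k S o s v ≡ true ⊎ ∃ λ u → ball k S o s u ≡ true × adjL k u v ≡ true
  ball-suc⁻ s {v} e with ∨-true⁻ {ball k S o s v} e
  ... | inj₁ bv = inj₁ bv
  ... | inj₂ p with anyB⁻ (allSubs _) (proj₂ (∧-true⁻ {S v} p))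
  ... | u , q = inj₂ (u , ∧-true⁻ q)

  ball-new : ∀ s {v} → ball k S o (suc s) v ≡ true → ball k S o s v ≡ false →
             ∃ λ u → ball k S o s u ≡ true × adjL k u v ≡ true
  ball-new s e f with ball-suc⁻ s e
  ... | inj₁ bv = ⊥-elim (not-¬ bv f)
  ... | inj₂ u  = u

  atDist⇒ball : ∀ d {v} → atDist k S o d v → ball k S o d v ≡ true
  atDist⇒ball zero    bv       = bv
  atDist⇒ball (suc d) (bv , _) = bv

  atDist-neighbour : ∀ d {w v} → ball k S o d w ≡ true → adjL k w v ≡ true →
                     S v ≡ true → ball k S o d v ≡ false → atDist k S o d w
  atDist-neighbour zero    bw _  _  _ = bw
  atDist-neighbour (suc d) {w} bw wv Sv f =
    bw , ¬-not (λ (bw′ : ball k S o d w ≡ true) → not-¬ (ball-step d bw′ wv Sv) f)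

  atDist-pred : ∀ d {v} → atDist k S o (suc d) v →
                ∃ λ u → atDist k S o d u × adjL k u v ≡ true
  atDist-pred d {v} (bv , f) with ball-new d bv f
  ... | u , bu , uv = u , atDist-neighbour d bu uv (ball-⊆ (suc d) bv) f , uv

  InBallOr : ℕ → List (Subset n) → Subset n → Set
  InBallOr d L x = ball k S o d x ≡ true ⊎ x ∈ L

  ≢-InBallOr : ∀ d {L a x} → ball k S o d a ≡ false → All (a ≢_) L → InBallOr d L x → a ≢ x
  ≢-InBallOr d a∉ _   (inj₁ bx)  = ≢-sym (ball-separates d bx a∉)
  ≢-InBallOr d _  a∉L (inj₂ x∈L) = All.lookup a∉L x∈L

  InBallOr-suc : ∀ d {y L x} → ball k S o d y ≡ true → InBallOr d (y ∷ L) x →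
                 InBallOr (suc d) L x
  InBallOr-suc d _  (inj₁ bx)          = inj₁ (ball-suc d bx)
  InBallOr-suc d by (inj₂ (here refl)) = inj₁ (ball-suc d by)
  InBallOr-suc d _  (inj₂ (there x∈L)) = inj₂ x∈L

  ≢-outside : ∀ d {a} xs → ball k S o d a ≡ true → All (λ x → ball k S o d x ≡ false) xs →
              All (a ≢_) xs
  ≢-outside d _ ba = All.map (ball-separates d ba)

  SimplePathTo : Subset n → List (Subset n) → Set
  SimplePathTo v xs =
    Linked (λ x y → adjL k x y ≡ true) (xs ++ [ v ]) × Unique xs × All (λ x → S x ≡ true) xs

  -- Descend along geodesics from a and from b in lockstep until they meet.
  geodesics-meet : ∀ d {v a b} bs → atDist k S o d a → atDist k S o d b → a ≢ b →
    SimplePathTo v (b ∷ bs) → All (λ x → ball k S o d x ≡ false) bs →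
    ∃₂ λ y ys → SimplePathTo v (a ∷ y ∷ ys) × All (InBallOr d (b ∷ bs)) (a ∷ y ∷ ys)
  geodesics-meet zero _ a₀ b₀ a≢b _ _ =
    ⊥-elim (a≢b (trans (ball-zero a₀) (sym (ball-zero b₀))))
  geodesics-meet (suc d) {a = a} {b} bs (ba , a∉) (bb , b∉) a≢b (walk , uniq , inS) outside
    with atDist-pred d (ba , a∉) | atDist-pred d (bb , b∉)
  ... | a′ , da′ , a′a | b′ , db′ , b′b with ≡-dec _≟ᵇ_ a′ b′
  ... | yes refl =
    let ba′ = atDist⇒ball d da′
    in  a′ , b ∷ bs
      , ( trans (adjL-sym a a′) a′a ∷ b′b ∷ walk
        , ( (≢-sym (ball-separates d ba′ a∉) ∷ a≢b ∷ ≢-outside (suc d) bs ba outside)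
          ∷ (ball-separates d ba′ b∉ ∷ ≢-outside (suc d) bs (ball-suc d ba′) outside)
          ∷ uniq)
        , ball-⊆ (suc d) ba ∷ ball-⊆ d ba′ ∷ inS)
      , inj₁ ba ∷ inj₁ (ball-suc d ba′) ∷ All.tabulate inj₂
  ... | no a′≢b′
    with geodesics-meet d (b ∷ bs) da′ db′ a′≢b′
           ( b′b ∷ walk
           , (ball-separates d bb′ b∉ ∷ ≢-outside (suc d) bs (ball-suc d bb′) outside) ∷ uniq
           , ball-⊆ d bb′ ∷ inS)
           (b∉ ∷ All.map (ball-suc-false d) outside)
    where bb′ = atDist⇒ball d db′
  ... | y , ys , (walk′ , uniq′ , inS′) , near =
      a′ , y ∷ ys
    , ( trans (adjL-sym a a′) a′a ∷ walk′
      , All.map (≢-InBallOr d a∉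
                  (≢-sym (ball-separates d bb′ a∉) ∷ a≢b ∷ ≢-outside (suc d) bs ba outside))
                near
        ∷ uniq′
      , ball-⊆ (suc d) ba ∷ inS′)
    , inj₁ ba ∷ All.map (InBallOr-suc d bb′) near
    where bb′ = atDist⇒ball d db′

  cycle-through-common-neighbour :
    ∀ d {a b v} → atDist k S o d a → atDist k S o d b → a ≢ b →
    S v ≡ true → ball k S o d v ≡ false → adjL k a v ≡ true → adjL k b v ≡ true →
    ∃ (IsCycleIn k S)
  cycle-through-common-neighbour d {a} {v = v} da db a≢b Sv v∉ av bv
    with geodesics-meet d [] da db a≢b (bv ∷ [-] , [] ∷ [] , ball-⊆ d bb ∷ []) []
    where bb = atDist⇒ball d db
  ... | y , ys , (walk , uniq , inS) , near =
      v ∷ a ∷ y ∷ ys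
    , s≤s (s≤s (s≤s z≤n))
    , All.map (≢-InBallOr d v∉ (≢-sym (ball-separates d bb v∉) ∷ [])) near ∷ uniq
    , Sv ∷ inS
    , trans (adjL-sym v a) av ∷ walk
    where bb = atDist⇒ball d db

module _ (k : ℕ) (S : Subset n → Bool) (o : Subset n) (o-size : sizeIs k o ≡ true) where

  ball-zero-size : ∀ v → ball k S o zero v ≡ true → sizeIs k v ≡ true
  ball-zero-size v b₀ = subst (λ x → sizeIs k x ≡ true) (sym (ball-zero k S o {v = v} b₀)) o-size

  mutual
    atDist-odd-size : ∀ {s v} → Even s → atDist k S o (suc s) v → sizeIs (suc k) v ≡ true
    atDist-odd-size {s} {v} e dv with atDist-pred k S o s dv
    atDist-odd-size {v = v} zero   _ | u , u₀ , uv =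
      Facet.X-size (adjL-from-k-set u v (ball-zero-size u u₀) uv)
    atDist-odd-size {v = v} (2+ e) _ | u , du , uv =
      Facet.X-size (adjL-from-k-set u v (atDist-even-size e du) uv)

    atDist-even-size : ∀ {s v} → Even s → atDist k S o (suc (suc s)) v → sizeIs k v ≡ true
    atDist-even-size {s} {v} e dv with atDist-pred k S o (suc s) dv
    ... | u , du , uv = Facet.Y-size (adjL-from-k+1-set u v (atDist-odd-size e du) uv)

  even-ball-k-set : ∀ {s v} → Even s → ball k S o (suc s) v ≡ true → sizeIs k v ≡ true →
                    ball k S o s v ≡ true
  even-ball-k-set {s} {v} e bv kv with ball k S o s v ≟ᵇ true
  ... | yes bv′ = bv′
  ... | no  v∉  = ⊥-elim (sizeIs-disjoint v kv (atDist-odd-size e (bv , ¬-not v∉)))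

  lower-neighbour : ∀ s {X} → ball k S o (suc s) X ≡ true → sizeIs (suc k) X ≡ true →
                    ∃ λ Y → ball k S o s Y ≡ true × adjL k Y X ≡ true
  lower-neighbour s {X} bX k+1X with ball k S o s X ≟ᵇ true
  lower-neighbour zero    {X} bX k+1X | yes bX′ =
    ⊥-elim (sizeIs-disjoint X (ball-zero-size X bX′) k+1X)
  lower-neighbour (suc s) bX k+1X | yes bX′ with lower-neighbour s bX′ k+1X
  ... | Y , bY , YX = Y , ball-suc k S o s bY , YX
  lower-neighbour s       bX k+1X | no X∉ = ball-new k S o s bX (¬-not X∉)

ball-monoˢ : ∀ k {S S′ : Subset n → Bool} o → (∀ {x} → S x ≡ true → S′ x ≡ true) →
             ∀ s {v} → ball k S o s v ≡ true → ball k S′ o s v ≡ true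
ball-monoˢ k {S} o S⊆S′ zero e with ∧-true⁻ {S o} e
... | So , v≈o = ∧-true⁺ (S⊆S′ So) v≈o
ball-monoˢ k {S} {S′} o S⊆S′ (suc s) e with ball-suc⁻ k S o s e
... | inj₁ bv            = ball-suc k S′ o s (ball-monoˢ k o S⊆S′ s bv)
... | inj₂ (u , bu , uv) =
  ball-step k S′ o s (ball-monoˢ k o S⊆S′ s bu) uv (S⊆S′ (ball-⊆ k S o (suc s) e))

ball-cong : ∀ k {S S′ : Subset n → Bool} o r → S o ≡ S′ o →
            (∀ s {u v} → s < r → ball k S′ o s u ≡ true → adjL k u v ≡ true → S v ≡ S′ v) →
            ∀ s → s ≤ r → ∀ v → ball k S o s v ≡ ball k S′ o s v
ball-cong k o r So≡S′o _ zero _ v = cong (_∧ eqSub v o) So≡S′o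
ball-cong {n} k {S} {S′} o r So≡S′o boundary (suc s) s<r v =
  begin
    ball k S o s v ∨ (S v ∧ anyB (λ u → ball k S o s u ∧ adjL k u v) (allSubs n))
  ≡⟨ cong₂ (λ c A → c ∨ (S v ∧ A)) (IH v)
           (anyB-cong (allSubs n) (λ u → cong (_∧ adjL k u v) (IH u))) ⟩
    ball k S′ o s v ∨ (S v ∧ anyB (λ u → ball k S′ o s u ∧ adjL k u v) (allSubs n))
  ≡⟨ cong (ball k S′ o s v ∨_) (∧-cong-guarded reached⇒agree) ⟩
    ball k S′ o s v ∨ (S′ v ∧ anyB (λ u → ball k S′ o s u ∧ adjL k u v) (allSubs n))
  ∎
  where
  open ≡-Reasoning
  IH : ∀ v → ball k S o s v ≡ ball k S′ o s v
  IH = ball-cong k o r So≡S′o boundary s (<⇒≤ s<r)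
  reached⇒agree : anyB (λ u → ball k S′ o s u ∧ adjL k u v) (allSubs n) ≡ true → S v ≡ S′ v
  reached⇒agree A with anyB⁻ (allSubs n) A
  ... | u , p = boundary s s<r (proj₁ (∧-true⁻ p)) (proj₂ (∧-true⁻ p))

module Events (k r : ℕ) (T : Subset n → Bool) (o : Subset n) (F : List (Subset n)) where

  private
    agrees : Subset n → Bool
    agrees X = eqB (inV n k r T o X ∧ memB X F) (T X)

  ballEvent⁻ : ballEvent n k r T o F ≡ true → ∀ v → ball k (inG k F) o r v ≡ T v
  ballEvent⁻ e v = eqB⁻ (allB-allSubs⁻ (λ v → eqB (ball k (inG k F) o r v) (T v)) e v)

  ballEvent⁺ : (∀ v → ball k (inG k F) o r v ≡ T v) → ballEvent n k r T o F ≡ true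
  ballEvent⁺ h = allB⁺ (allSubs n) (λ v → eqB⁺ (h v))

  vEvent⁻ : vEvent n k r T o F ≡ true →
            ∀ X → sizeIs (suc k) X ≡ true → inV n k r T o X ∧ memB X F ≡ T X
  vEvent⁻ e X k+1X = eqB⁻ (subst (λ c → not c ∨ agrees X ≡ true) k+1X (allB-allSubs⁻ _ e X))

  vEvent⁺ : (∀ X → sizeIs (suc k) X ≡ true → inV n k r T o X ∧ memB X F ≡ T X) →
            vEvent n k r T o F ≡ true
  vEvent⁺ h = allB⁺ (allSubs n) each
    where
    each : ∀ X → not (sizeIs (suc k) X) ∨ agrees X ≡ true
    each X with sizeIs (suc k) X ≟ᵇ true
    ... | yes k+1X = subst (λ c → not c ∨ agrees X ≡ true) (sym k+1X) (eqB⁺ (h X k+1X))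
    ... | no ¬k+1X rewrite ¬-not ¬k+1X = refl

inG-k+1-set : ∀ k (F : List (Subset n)) X → sizeIs (suc k) X ≡ true → inG k F X ≡ memB X F
inG-k+1-set k F X k+1X = cong (_∨ memB X F) (sizeIs-suc⇒¬sizeIs X k+1X)

module _ (k : ℕ) (T : Subset n → Bool) (o : Subset n) where

  inV⁺ : ∀ q {Y X} → Facet k Y X → ball k T o q Y ≡ true →
         inV n k (suc (suc q)) T o X ≡ true
  inV⁺ q {Y} {X} (facet x y y⊆x) bY =
    ∧-true⁺ x (anyB-allSubs⁺ (λ Y → sizeIs k Y ∧ subB Y X ∧ ball k T o q Y) Y
                             (∧-true⁺ y (∧-true⁺ y⊆x bY)))

  inV⁻ : ∀ r {X} → inV n k r T o X ≡ true →
         ∃₂ λ q Y → r ≡ suc (suc q) × Facet k Y X × ball k T o q Y ≡ true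
  inV⁻ r {X} e with ∧-true⁻ {sizeIs (suc k) X} e
  ... | x , some with anyB⁻ (allSubs n) some
  ... | Y , p with ∧-true⁻ {sizeIs k Y} p
  ... | y , q with ∧-true⁻ {subB Y X} q
  ... | y⊆x , bY = below r bY
    where
    below : ∀ r → ballMinus2 k T o r Y ≡ true →
            ∃₂ λ q Y′ → r ≡ suc (suc q) × Facet k Y′ X × ball k T o q Y′ ≡ true
    below zero          ()
    below (suc zero)    ()
    below (suc (suc q)) bY = q , Y , refl , facet x y y⊆x , bY

module Rooted (k : ℕ) (T : Subset n → Bool) (o : Subset n)
              (rooted : IsRootedProperSubtree k T o) where

  o-size : sizeIs k o ≡ true
  o-size = proj₁ (proj₂ rooted)

  T-o : T o ≡ true
  T-o = proj₂ (proj₂ rooted)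

  in-L : IsVertexSetOfL k T
  in-L = proj₁ (proj₁ (proj₁ rooted))

  acyclic : ∀ vs → ¬ IsCycleIn k T vs
  acyclic = proj₂ (proj₂ (proj₁ (proj₁ rooted)))

  closed : ∀ X → T X ≡ true → sizeIs (suc k) X ≡ true →
           ∀ Y → adjL k X Y ≡ true → T Y ≡ true
  closed = proj₂ (proj₁ rooted)

  WithinDepth : ℕ → Set
  WithinDepth r = ∀ v → T v ≡ true → ball k T o r v ≡ true

  ball-depth : ∀ r → WithinDepth r → ∀ v → ball k T o r v ≡ T v
  ball-depth r depth v = ≡-from-⇔ (ball-⊆ k T o r) (depth v)

  inV-k-set-neighbour : ∀ {r s u v} → Even r → s < r → ball k T o s u ≡ true →
                        sizeIs k u ≡ true → adjL k u v ≡ true → inV n k r T o v ≡ true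
  inV-k-set-neighbour {u = u} {v} (2+_ {q} e) s<r bu ku uv =
    inV⁺ k T o q (adjL-from-k-set u v ku uv)
      (even-ball-k-set k T o o-size {v = u} e (ball-mono k T o (≤-pred s<r) bu) ku)

  inV-of-T : ∀ {r X} → Even r → WithinDepth r → T X ≡ true → sizeIs (suc k) X ≡ true →
             inV n k r T o X ≡ true
  inV-of-T {X = X} zero depth TX k+1X =
    ⊥-elim (sizeIs-disjoint X (ball-zero-size k T o o-size X (depth X TX)) k+1X)
  inV-of-T {X = X} (2+_ {q} e) depth TX k+1X
    with lower-neighbour k T o o-size (suc q) (depth X TX) k+1X
  ... | Y , bY , YX = inV⁺ k T o q f (even-ball-k-set k T o o-size {v = Y} e bY (Facet.Y-size f))
    where f = adjL-from-k+1-set X Y k+1X (trans (adjL-sym X Y) YX)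

  vEvent⇒ballEvent : ∀ {r} → Even r → WithinDepth r → ∀ F →
                     vEvent n k r T o F ≡ true → ballEvent n k r T o F ≡ true
  vEvent⇒ballEvent {r} e depth F vE =
    ballEvent⁺ (λ v → trans (ball-cong k o r G-o boundary r ≤-refl v) (ball-depth r depth v))
    where
    open Events k r T o F
    open ≡-Reasoning
    G-o : inG k F o ≡ T o
    G-o = trans (∨-true⁺ˡ o-size) (sym T-o)
    boundary : ∀ s {u v} → s < r → ball k T o s u ≡ true → adjL k u v ≡ true → inG k F v ≡ T v
    boundary s {u} {v} s<r bu uv with adjL⇒facet u v uv
    ... | inj₁ (facet k+1u kv _) =
      trans (∨-true⁺ˡ kv) (sym (closed u (ball-⊆ k T o s bu) k+1u v uv))
    ... | inj₂ (facet k+1v ku _) =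
      begin
        inG k F v                   ≡⟨ inG-k+1-set k F v k+1v ⟩
        memB v F                    ≡⟨ cong (_∧ memB v F) (sym v∈V) ⟩
        inV n k r T o v ∧ memB v F  ≡⟨ vEvent⁻ vE v k+1v ⟩
        T v
      ∎
      where v∈V = inV-k-set-neighbour e s<r bu ku uv

  ballEvent⇒vEvent : ∀ {r} → Even r → WithinDepth r → ∀ F →
                     ballEvent n k r T o F ≡ true → vEvent n k r T o F ≡ true
  ballEvent⇒vEvent {r} e depth F bE =
    vEvent⁺ (λ X k+1X → ≡-from-⇔ (faces⊆T k+1X) (T⊆faces k+1X))
    where
    open Events k r T o F
    T⊆G : ∀ {x} → T x ≡ true → inG k F x ≡ true
    T⊆G {x} Tx = ball-⊆ k (inG k F) o r (trans (ballEvent⁻ bE x) Tx)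
    faces⊆T : ∀ {X} → sizeIs (suc k) X ≡ true →
              inV n k r T o X ∧ memB X F ≡ true → T X ≡ true
    faces⊆T {X} k+1X p with ∧-true⁻ {inV n k r T o X} p
    ... | X∈V , X∈F with inV⁻ k T o r X∈V
    ... | q , Y , refl , f , bY =
      trans (sym (ballEvent⁻ bE X))
            (ball-suc k (inG k F) o (suc q)
              (ball-step k (inG k F) o q (ball-monoˢ k o T⊆G q bY) (facet⇒adjL-up f)
                         (trans (inG-k+1-set k F X k+1X) X∈F)))
    T⊆faces : ∀ {X} → sizeIs (suc k) X ≡ true → T X ≡ true →
              inV n k r T o X ∧ memB X F ≡ true
    T⊆faces {X} k+1X TX =
      ∧-true⁺ (inV-of-T e depth TX k+1X) (trans (sym (inG-k+1-set k F X k+1X)) (T⊆G TX))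

  events-agree : ∀ {r} → Even r → WithinDepth r →
                 ∀ F → ballEvent n k r T o F ≡ vEvent n k r T o F
  events-agree e depth F = ≡-from-⇔ (ballEvent⇒vEvent e depth F) (vEvent⇒ballEvent e depth F)

module _ (k : ℕ) (T : Subset n → Bool) (o : Subset n)
         (rooted : IsRootedProperSubtree (suc k) T o) where
  open Rooted (suc k) T o rooted

  odd-depth-impossible : ∀ {s} → Even s → ¬ HasDepth (suc k) T o (suc s)
  odd-depth-impossible {s} e (depth , v , Tv , bv , v∉) with ∨-true⁻ (in-L v Tv)
  ... | inj₁ kv   = not-¬ (even-ball-k-set (suc k) T o o-size e bv kv) v∉
  ... | inj₂ k+1v with two-facets v k+1v
  ... | w₁ , w₂ , w₁≢w₂ , f₁ , f₂ =
    acyclic _ (proj₂ (cycle-through-common-neighbour (suc k) T o s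
                        (facet-atDist f₁) (facet-atDist f₂) w₁≢w₂ Tv v∉
                        (facet⇒adjL-up f₁) (facet⇒adjL-up f₂)))
    where
    facet-atDist : ∀ {w} → Facet (suc k) w v → atDist (suc k) T o s w
    facet-atDist {w} f = atDist-neighbour (suc k) T o s bw (facet⇒adjL-up f) Tv v∉
      where
      Tw = closed v Tv k+1v w (facet⇒adjL-down f)
      bw = even-ball-k-set (suc k) T o o-size e (depth w Tw) (Facet.Y-size f)

νNumerator-cong : ∀ n k h {E E′ : List (Subset n) → Bool} → (∀ F → E F ≡ E′ F) →
                  νNumerator n k h E ≡ νNumerator n k h E′
νNumerator-cong n k h E≗E′ =
  cong sumℕ (map-cong (λ F → cong (λ c → if c then h F * h F else 0) (E≗E′ F)) (faceSets n k))

-- The events agree on every face set.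
proposition3p4 : (n k r : ℕ) → 1 ≤ k →
    (T : Subset n → Bool) (o : Subset n) →
    IsRootedProperSubtree k T o → HasDepth k T o r →
    (h : List (Subset n) → ℕ) → IsHomologyOrderFn n k h →
    νNumerator n k h (ballEvent n k r T o) ≡ νNumerator n k h (vEvent n k r T o)
proposition3p4 n (suc k) r (s≤s z≤n) T o rooted depth h _ with parity r
... | odd e  = ⊥-elim (odd-depth-impossible k T o rooted e depth)
... | even e =
  νNumerator-cong n (suc k) h (Rooted.events-agree (suc k) T o rooted e (proj₁ depth))
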